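{- For any p-strings $x$ and $y$, $\mathrm{lcp}^\infty(\langle x\rangle,\langle y\rangle)\le \mathrm{lcp}^\infty(\langle x[2..]\rangle,\langle y[2..]\rangle)+1$.
   Context: $\Sigma_s$ and $\Sigma_p$ are disjoint alphabets; a p-string is a string over $\Sigma_s\cup\Sigma_p$. Strings are 1-indexed; $w[i..]$ denotes the suffix starting at position $i$ (empty if $i>|w|$). $\infty$ is a symbol larger than every integer. The p-encoding $\langle w\rangle$ of a p-string $w$ is the string of length $|w|$ with $\langle w\rangle[i]=w[i]$ if $w[i]\in\Sigma_s$; $\langle w\rangle[i]=\infty$ if $w[i]\in\Sigma_p$ does not occur in $w[..i-1]$; and $\langle w\rangle[i]=i-j$ otherwise, where $j$ is the largest position in $[1..i-1]$ with $w[j]=w[i]$. For p-strings $u,v$, $\mathrm{lcp}^\infty(\langle u\rangle,\langle v\rangle)$ is the number of occurrences of $\infty$ in the longest common prefix of $\langle u\rangle$ and $\langle v\rangle$. -}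

module Defs where

open import Data.Nat using (ℕ; zero; suc)
open import Data.List using (List; []; _∷_; drop)
open import Data.Sum using (_⊎_; inj₁; inj₂)
open import Data.Maybe using (Maybe; just; nothing)
open import Relation.Binary.Definitions using (DecidableEquality)
open import Relation.Binary.PropositionalEquality using (_≡_; refl)
open import Relation.Nullary using (yes; no)

-- Σs and Σp are modelled as types S and P with decidable equality;
-- disjointness is built in by using the sum type S ⊎ P as the alphabet.
module _ {S P : Set} (_≟S_ : DecidableEquality S) (_≟P_ : DecidableEquality P) where

  PString : Set
  PString = List (S ⊎ P)

  data EncSym : Set where
    sym : S → EncSym
    ∞   : EncSym
    num : ℕ → EncSym

  -- distance to the nearest earlier occurrence of p, given the prefix
  -- in reversed order (nearest first); nothing if p does not occur.
  dist : P → List (S ⊎ P) → Maybe ℕ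
  dist p [] = nothing
  dist p (inj₁ _ ∷ rev) with dist p rev
  ... | just d  = just (suc d)
  ... | nothing = nothing
  dist p (inj₂ q ∷ rev) with p ≟P q
  ... | yes _ = just 1
  ... | no  _ with dist p rev
  ...   | just d  = just (suc d)
  ...   | nothing = nothing

  encSym : List (S ⊎ P) → S ⊎ P → EncSym
  encSym rev (inj₁ s) = sym s
  encSym rev (inj₂ p) with dist p rev
  ... | just d  = num d
  ... | nothing = ∞

  encodeAcc : List (S ⊎ P) → PString → List EncSym
  encodeAcc rev [] = []
  encodeAcc rev (c ∷ w) = encSym rev c ∷ encodeAcc (c ∷ rev) w

  ⟨_⟩ : PString → List EncSym
  ⟨ w ⟩ = encodeAcc [] w

  _≟E_ : DecidableEquality EncSym
  sym a ≟E sym b with a ≟S b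
  ... | yes refl = yes refl
  ... | no ne = no (λ { refl → ne refl })
  sym _ ≟E ∞ = no (λ ())
  sym _ ≟E num _ = no (λ ())
  ∞ ≟E sym _ = no (λ ())
  ∞ ≟E ∞ = yes refl
  ∞ ≟E num _ = no (λ ())
  num _ ≟E sym _ = no (λ ())
  num _ ≟E ∞ = no (λ ())
  num m ≟E num n with m Data.Nat.≟ n
  ... | yes refl = yes refl
  ... | no ne = no (λ { refl → ne refl })

  lcp∞ : List EncSym → List EncSym → ℕ
  lcp∞ [] _ = zero
  lcp∞ (_ ∷ _) [] = zero
  lcp∞ (a ∷ u) (b ∷ v) with a ≟E b
  ... | no _ = zero
  ... | yes _ with a
  ...   | ∞ = suc (lcp∞ u v)
  ...   | _ = lcp∞ u v

-- ⟨x[2..]⟩ is obtained from ⟨x⟩[2..] by replacing each distance that reaches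
-- back to position 1 by ∞.  This replacement acts position-wise, so it
-- preserves common prefixes and can only add ∞'s to them; dropping the first
-- position of ⟨x⟩ and ⟨y⟩ loses at most one ∞.
module Submission where

open import Defs
open import Data.Nat using (ℕ; _≤_; _+_; suc; z≤n; s≤s; _≟_)
open import Data.Nat.Properties using (≤-refl; <⇒≢; +-comm; +-mono-≤; +-monoˡ-≤)
open import Data.Sum using (_⊎_; inj₁; inj₂)
open import Data.List using (List; drop; []; _∷_; _∷ʳ_; length)
open import Data.Maybe using (Maybe; just; nothing)
open import Relation.Binary.Definitions using (DecidableEquality)
open import Relation.Binary.PropositionalEquality using (_≡_; _≢_; refl)
open import Relation.Nullary using (Dec; yes; no; contradiction)

module _ {S P : Set} (_≟S_ : DecidableEquality S) (_≟P_ : DecidableEquality P) where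

  private
    Sym : Set
    Sym = EncSym _≟S_ _≟P_

    Sym? : DecidableEquality Sym
    Sym? = _≟E_ _≟S_ _≟P_

    lcp : List Sym → List Sym → ℕ
    lcp = lcp∞ _≟S_ _≟P_

    distance : P → List (S ⊎ P) → Maybe ℕ
    distance = dist _≟S_ _≟P_

    encode : List (S ⊎ P) → List (S ⊎ P) → List Sym
    encode = encodeAcc _≟S_ _≟P_

  dist-≤-length : ∀ p rev {d} → distance p rev ≡ just d → d ≤ length rev
  dist-≤-length p (inj₁ _ ∷ rev) eq with distance p rev in e
  dist-≤-length p (inj₁ _ ∷ rev) refl | just d = s≤s (dist-≤-length p rev e)
  dist-≤-length p (inj₂ q ∷ rev) eq with p ≟P q
  dist-≤-length p (inj₂ q ∷ rev) refl | yes _ = s≤s z≤n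
  ... | no _ with distance p rev in e
  dist-≤-length p (inj₂ q ∷ rev) refl | no _ | just d = s≤s (dist-≤-length p rev e)

  dist-∷ʳ-just : ∀ p rev c {d} → distance p rev ≡ just d → distance p (rev ∷ʳ c) ≡ just d
  dist-∷ʳ-just p (inj₁ _ ∷ rev) c eq with distance p rev in e
  dist-∷ʳ-just p (inj₁ _ ∷ rev) c refl | just d rewrite dist-∷ʳ-just p rev c e = refl
  dist-∷ʳ-just p (inj₂ q ∷ rev) c eq with p ≟P q
  dist-∷ʳ-just p (inj₂ q ∷ rev) c refl | yes _ = refl
  ... | no _ with distance p rev in e
  dist-∷ʳ-just p (inj₂ q ∷ rev) c refl | no _ | just d rewrite dist-∷ʳ-just p rev c e = refl

  dist-∷ʳ-nothing : ∀ p rev c → distance p rev ≡ nothing →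
    distance p (rev ∷ʳ c) ≡ nothing ⊎ distance p (rev ∷ʳ c) ≡ just (suc (length rev))
  dist-∷ʳ-nothing p [] (inj₁ _) _ = inj₁ refl
  dist-∷ʳ-nothing p [] (inj₂ q) _ with p ≟P q
  ... | yes _ = inj₂ refl
  ... | no _  = inj₁ refl
  dist-∷ʳ-nothing p (inj₁ _ ∷ rev) c eq with distance p rev in e
  ... | nothing with dist-∷ʳ-nothing p rev c e
  ...   | inj₁ r rewrite r = inj₁ refl
  ...   | inj₂ r rewrite r = inj₂ refl
  dist-∷ʳ-nothing p (inj₂ q ∷ rev) c eq with p ≟P q
  ... | no _ with distance p rev in e
  ...   | nothing with dist-∷ʳ-nothing p rev c e
  ...     | inj₁ r rewrite r = inj₁ refl
  ...     | inj₂ r rewrite r = inj₂ refl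

  -- A back-reference to a position that has been cut off becomes a first occurrence.
  cutRef : ℕ → Sym → Sym
  cutRef k (num d) with d ≟ k
  ... | yes _ = ∞
  ... | no _  = num d
  cutRef k e = e

  cutRefs : ℕ → List Sym → List Sym
  cutRefs k [] = []
  cutRefs k (e ∷ es) = cutRef k e ∷ cutRefs (suc k) es

  cutRef-self : ∀ k → ∞ ≡ cutRef k (num k)
  cutRef-self k with k ≟ k
  ... | yes _ = refl
  ... | no k≢k = contradiction refl k≢k

  cutRef-short : ∀ {d k} → d ≤ k → num d ≡ cutRef (suc k) (num d)
  cutRef-short {d} {k} d≤k with d ≟ suc k
  ... | yes d≡1+k = contradiction d≡1+k (<⇒≢ (s≤s d≤k))
  ... | no _ = refl

  encSym-∷ʳ : ∀ rev c a →
    encSym _≟S_ _≟P_ rev a ≡ cutRef (suc (length rev)) (encSym _≟S_ _≟P_ (rev ∷ʳ c) a)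
  encSym-∷ʳ rev c (inj₁ s) = refl
  encSym-∷ʳ rev c (inj₂ p) with distance p rev in e
  ... | just d rewrite dist-∷ʳ-just p rev c e = cutRef-short (dist-≤-length p rev e)
  ... | nothing with dist-∷ʳ-nothing p rev c e
  ...   | inj₁ r rewrite r = refl
  ...   | inj₂ r rewrite r = cutRef-self (suc (length rev))

  -- The accumulator holds the prefix reversed, so rev ∷ʳ c places c before it.
  encode-∷ʳ : ∀ rev c w → encode rev w ≡ cutRefs (suc (length rev)) (encode (rev ∷ʳ c) w)
  encode-∷ʳ rev c [] = refl
  encode-∷ʳ rev c (a ∷ w) rewrite encSym-∷ʳ rev c a | encode-∷ʳ (a ∷ rev) c w = refl

  count∞ : Sym → ℕ
  count∞ ∞ = 1
  count∞ _ = 0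

  count∞-cutRef : ∀ k a → count∞ a ≤ count∞ (cutRef k a)
  count∞-cutRef k (sym _) = z≤n
  count∞-cutRef k ∞       = ≤-refl
  count∞-cutRef k (num _) = z≤n

  lcp∞-∷ : ∀ a X Y → lcp (a ∷ X) (a ∷ Y) ≡ count∞ a + lcp X Y
  lcp∞-∷ a X Y with Sym? a a
  ... | no a≢a = contradiction refl a≢a
  lcp∞-∷ (sym _) X Y | yes _ = refl
  lcp∞-∷ ∞       X Y | yes _ = refl
  lcp∞-∷ (num _) X Y | yes _ = refl

  lcp∞-∷-≢ : ∀ {a b} X Y → a ≢ b → lcp (a ∷ X) (b ∷ Y) ≡ 0
  lcp∞-∷-≢ {a} {b} X Y a≢b with Sym? a b
  ... | yes a≡b = contradiction a≡b a≢b
  ... | no _    = refl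

  lcp∞-cutRefs : ∀ k X Y → lcp X Y ≤ lcp (cutRefs k X) (cutRefs k Y)
  lcp∞-cutRefs k [] Y = z≤n
  lcp∞-cutRefs k (a ∷ X) [] = z≤n
  lcp∞-cutRefs k (a ∷ X) (b ∷ Y) = by-cases (Sym? a b)
    where
    by-cases : Dec (a ≡ b) → lcp (a ∷ X) (b ∷ Y) ≤ lcp (cutRefs k (a ∷ X)) (cutRefs k (b ∷ Y))
    by-cases (no a≢b) rewrite lcp∞-∷-≢ X Y a≢b = z≤n
    by-cases (yes refl)
      rewrite lcp∞-∷ a X Y | lcp∞-∷ (cutRef k a) (cutRefs (suc k) X) (cutRefs (suc k) Y) =
      +-mono-≤ (count∞-cutRef k a) (lcp∞-cutRefs (suc k) X Y)

  lcp∞-∷-≤ : ∀ a b X Y → lcp (a ∷ X) (b ∷ Y) ≤ lcp X Y + 1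
  lcp∞-∷-≤ a b X Y = by-cases (Sym? a b)
    where
    count∞-≤-1 : ∀ a → count∞ a ≤ 1
    count∞-≤-1 (sym _) = z≤n
    count∞-≤-1 ∞       = ≤-refl
    count∞-≤-1 (num _) = z≤n

    by-cases : Dec (a ≡ b) → lcp (a ∷ X) (b ∷ Y) ≤ lcp X Y + 1
    by-cases (no a≢b) rewrite lcp∞-∷-≢ X Y a≢b = z≤n
    by-cases (yes refl) rewrite lcp∞-∷ a X Y | +-comm (lcp X Y) 1 = +-monoˡ-≤ (lcp X Y) (count∞-≤-1 a)

corollary1 : {S P : Set} (_≟S_ : DecidableEquality S) (_≟P_ : DecidableEquality P)
    → (x y : List (S ⊎ P))
    → lcp∞ _≟S_ _≟P_ (⟨_⟩ _≟S_ _≟P_ x) (⟨_⟩ _≟S_ _≟P_ y)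
        ≤ lcp∞ _≟S_ _≟P_ (⟨_⟩ _≟S_ _≟P_ (drop 1 x)) (⟨_⟩ _≟S_ _≟P_ (drop 1 y)) + 1
corollary1 _≟S_ _≟P_ [] y = z≤n
corollary1 _≟S_ _≟P_ (c ∷ x) [] = z≤n
corollary1 _≟S_ _≟P_ (c ∷ x) (d ∷ y)
  rewrite encode-∷ʳ _≟S_ _≟P_ [] c x | encode-∷ʳ _≟S_ _≟P_ [] d y =
  begin
    lcp (encSym _≟S_ _≟P_ [] c ∷ X) (encSym _≟S_ _≟P_ [] d ∷ Y)
  ≤⟨ lcp∞-∷-≤ _≟S_ _≟P_ (encSym _≟S_ _≟P_ [] c) (encSym _≟S_ _≟P_ [] d) X Y ⟩
    lcp X Y + 1
  ≤⟨ +-monoˡ-≤ 1 (lcp∞-cutRefs _≟S_ _≟P_ 1 X Y) ⟩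
    lcp (cutRefs _≟S_ _≟P_ 1 X) (cutRefs _≟S_ _≟P_ 1 Y) + 1
  ∎
  where
  open Data.Nat.Properties.≤-Reasoning
  lcp : List (EncSym _≟S_ _≟P_) → List (EncSym _≟S_ _≟P_) → ℕ
  lcp = lcp∞ _≟S_ _≟P_

  X Y : List (EncSym _≟S_ _≟P_)
  X = encodeAcc _≟S_ _≟P_ (c ∷ []) x
  Y = encodeAcc _≟S_ _≟P_ (d ∷ []) y
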